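{- Let $G$ and $H$ be two connected noncomplete graphs, each on $n$ vertices. If $\tau(G)\neq\tau(H)$, then $|\tau(G)-\tau(H)|>1/n^2$.
   Context: All graphs are finite, simple and undirected; $\omega(H)$ denotes the number of connected components of $H$. For a real $t$, a graph $G$ is $t$-tough if $|S|\ge t\,\omega(G-S)$ for every $S\subseteq V(G)$ with $\omega(G-S)>1$. The toughness $\tau(G)$ is the largest $t$ for which $G$ is $t$-tough. -}

module Defs where

open import Data.Bool using (Bool; true; false)
open import Data.Nat as ℕ using (ℕ; zero; suc)
open import Data.Fin using (Fin)
open import Data.Fin.Subset using (Subset; _∉_; ∣_∣; ⊥)
open import Data.Integer using (+_)
open import Data.Rational using (ℚ; _/_; _*_; _≤_; 0ℚ)
open import Data.Product using (Σ; ∃; _×_; _,_)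
open import Relation.Binary.PropositionalEquality using (_≡_; _≢_)
open import Function.Bundles using (_⇔_)

record Graph (n : ℕ) : Set where
  field
    Adj   : Fin n → Fin n → Bool
    sym   : ∀ u v → Adj u v ≡ Adj v u
    irrefl : ∀ v → Adj v v ≡ false
open Graph public

data Reach {n : ℕ} (G : Graph n) (S : Subset n) : Fin n → Fin n → Set where
  here : ∀ {v} → v ∉ S → Reach G S v v
  step : ∀ {u w v} → u ∉ S → Adj G u w ≡ true → Reach G S w v → Reach G S u v

-- HasComponents G S k : the graph G - S has exactly k connected components,
-- witnessed by a surjective labelling of the vertices of G - S by Fin k
-- whose fibres are exactly the connected components.
HasComponents : {n : ℕ} → Graph n → Subset n → ℕ → Set
HasComponents {n} G S k =
  Σ ((v : Fin n) → v ∉ S → Fin k) λ c →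
    (∀ (i : Fin k) → ∃ λ v → Σ (v ∉ S) λ p → c v p ≡ i) ×
    (∀ u (p : u ∉ S) v (q : v ∉ S) → (c u p ≡ c v q) ⇔ Reach G S u v)

ℕ→ℚ : ℕ → ℚ
ℕ→ℚ k = (+ k) / 1

Connected : {n : ℕ} → Graph n → Set
Connected G = ∀ u v → Reach G ⊥ u v

NonComplete : {n : ℕ} → Graph n → Set
NonComplete {n} G = Σ (Fin n) λ u → Σ (Fin n) λ v → (u ≢ v) × (Adj G u v ≡ false)

Tough : {n : ℕ} → Graph n → ℚ → Set
Tough {n} G t = ∀ (S : Subset n) (k : ℕ) → HasComponents G S k → 1 ℕ.< k →
  t * ℕ→ℚ k ≤ ℕ→ℚ ∣ S ∣

IsToughness : {n : ℕ} → Graph n → ℚ → Set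
IsToughness G t = Tough G t × (∀ t' → t Data.Rational.< t' → Tough G t' → Data.Empty.⊥)
  where import Data.Rational; import Data.Empty

-- 1/n² (the value at n = 0 is irrelevant: noncomplete graphs have n ≥ 2).
1/n² : ℕ → ℚ
1/n² zero = 0ℚ
1/n² (suc m) = (+ 1) / (suc m ℕ.* suc m)

-- If no separating set S is tight (|S| = τ ω(G − S)), every toughness constraint
-- holds strictly. Connectivity forces ω(G − S) < n, and for τ = p/q the slack in a
-- strict constraint |S| > τ k is at least 1/q, so τ + 1/(q(n+1)) still satisfies all of
-- them, contradicting maximality. Hence (classically) τ = a/k with 0 < k < n, and two
-- distinct such fractions differ by at least 1/(k k') > 1/n².
module Submission where

open import Defs hiding (sym)
open import Data.Nat as ℕ using (ℕ; zero; suc; z≤n; s≤s)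
import Data.Nat.Properties as ℕP
open import Data.Fin using (Fin; punchOut) renaming (zero to fz; suc to fs)
open import Data.Fin.Properties using (punchOut-injective; injective⇒≤)
open import Data.Fin.Subset using (Subset; _∈_; _∉_) renaming (⊥ to ∅; ∣_∣ to card)
open import Data.Fin.Subset.Properties using (_∈?_)
open import Data.Integer as ℤ using (ℤ; +_; +[1+_]; 1ℤ; +≤+; +<+)
import Data.Integer.Properties as ℤP
open import Data.Integer.Tactic.RingSolver using (solve-∀)
open import Data.Rational as ℚ using (ℚ; mkℚ; toℚᵘ; fromℚᵘ; _<_; _-_; ∣_∣)
import Data.Rational.Properties as ℚP
open import Data.Rational.Unnormalised as U using (ℚᵘ; mkℚᵘ; *<*; *≤*; *≡*)
import Data.Rational.Unnormalised.Properties as UP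
open import Data.Product using (Σ; ∃₂; _×_; _,_; proj₁; proj₂)
open import Data.Sum using (_⊎_; inj₁; inj₂)
open import Function.Bundles using (Equivalence)
open import Function.Definitions using (Injective)
open import Relation.Binary.Definitions using (tri<; tri≈; tri>)
open import Relation.Binary.PropositionalEquality
open import Relation.Nullary using (¬_; yes; no; contradiction)
open import Relation.Nullary.Decidable using (decidable-stable)

walk-meets⊎avoids : ∀ {n} {G : Graph n} (S : Subset n) {u v} →
  Reach G ∅ u v → Σ (Fin n) (_∈ S) ⊎ Reach G S u v
walk-meets⊎avoids S {u} walk with u ∈? S
walk-meets⊎avoids S {u} walk             | yes u∈S = inj₁ (u , u∈S)
walk-meets⊎avoids S {u} (here _)         | no u∉S  = inj₂ (here u∉S)
walk-meets⊎avoids S {u} (step _ uw walk) | no u∉S with walk-meets⊎avoids S walk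
... | inj₁ meets = inj₁ meets
... | inj₂ avoids = inj₂ (step u∉S uw avoids)

injective-avoiding⇒< : ∀ {k n} {f : Fin k → Fin n} → Injective _≡_ _≡_ f →
  (w : Fin n) → (∀ i → w ≢ f i) → k ℕ.< n
injective-avoiding⇒< {n = zero} _ () _
injective-avoiding⇒< {n = suc _} {f} f-inj w w∉f =
  s≤s (injective⇒≤ (λ {i} {j} eq → f-inj (punchOut-injective (w∉f i) (w∉f j) eq)))

module ComponentLabelling {n} {G : Graph n} {S : Subset n} {k} (hc : HasComponents G S k) where

  label : (v : Fin n) → v ∉ S → Fin k
  label = proj₁ hc

  rep : Fin k → Fin n
  rep i = proj₁ (proj₁ (proj₂ hc) i)

  rep∉S : ∀ i → rep i ∉ S
  rep∉S i = proj₁ (proj₂ (proj₁ (proj₂ hc) i))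

  label-rep : ∀ i → label (rep i) (rep∉S i) ≡ i
  label-rep i = proj₂ (proj₂ (proj₁ (proj₂ hc) i))

  reach-rep⇒≡ : ∀ {i j} → Reach G S (rep i) (rep j) → i ≡ j
  reach-rep⇒≡ {i} {j} r = begin
    i                       ≡⟨ label-rep i ⟨
    label (rep i) (rep∉S i) ≡⟨ Equivalence.from (proj₂ (proj₂ hc) _ (rep∉S i) _ (rep∉S j)) r ⟩
    label (rep j) (rep∉S j) ≡⟨ label-rep j ⟩
    j                       ∎
    where open ≡-Reasoning

  rep-injective : Injective _≡_ _≡_ rep
  rep-injective {i} eq = reach-rep⇒≡ (subst (Reach G S (rep i)) eq (here (rep∉S i)))

  -- Two representatives are joined in G but not in G − S, so some vertex of S is
  -- not a representative.
  components<order : Connected G → 1 ℕ.< k → k ℕ.< n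
  components<order conn (s≤s (s≤s z≤n)) with walk-meets⊎avoids S (conn (rep fz) (rep (fs fz)))
  ... | inj₁ (w , w∈S) = injective-avoiding⇒< rep-injective w (λ i w≡ → rep∉S i (subst (_∈ S) w≡ w∈S))
  ... | inj₂ r with reach-rep⇒≡ r
  ...   | ()

ℕ→ℚᵘ : ℕ → ℚᵘ
ℕ→ℚᵘ k = mkℚᵘ (+ k) 0

toℚᵘ-ℕ→ℚ : ∀ k → toℚᵘ (ℕ→ℚ k) U.≃ ℕ→ℚᵘ k
toℚᵘ-ℕ→ℚ k = ℚP.toℚᵘ-fromℚᵘ (ℕ→ℚᵘ k)

toℚᵘ-*ℕ→ℚ : ∀ x k → toℚᵘ (x ℚ.* ℕ→ℚ k) U.≃ toℚᵘ x U.* ℕ→ℚᵘ k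
toℚᵘ-*ℕ→ℚ x k = UP.≃-trans (ℚP.toℚᵘ-homo-* x (ℕ→ℚ k)) (UP.*-congˡ {toℚᵘ x} (toℚᵘ-ℕ→ℚ k))

*ℕ→ℚᵘ : ∀ p d k → mkℚᵘ p d U.* ℕ→ℚᵘ k U.≃ mkℚᵘ (p ℤ.* + k) d
*ℕ→ℚᵘ p d k = *≡* (cong (λ e → p ℤ.* + k ℤ.* + e) (sym (ℕP.*-identityʳ (suc d))))

≤∧≢⇒< : ∀ {p q : ℚ} → p ℚ.≤ q → p ≢ q → p < q
≤∧≢⇒< {p} {q} p≤q p≢q with ℚP.<-cmp p q
... | tri< p<q _ _ = p<q
... | tri≈ _ p≡q _ = contradiction p≡q p≢q
... | tri> _ _ p>q = contradiction (ℚP.≤-<-trans p≤q p>q) (ℚP.<-irrefl refl)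

toℚᵘ-*ℕ→ℚ-cross : ∀ r k → toℚᵘ (r ℚ.* ℕ→ℚ k) U.≃ mkℚᵘ (ℚ.↥ r ℤ.* + k) (ℚ.denominator-1 r)
toℚᵘ-*ℕ→ℚ-cross r@(mkℚ p d _) k = UP.≃-trans (toℚᵘ-*ℕ→ℚ r k) (*ℕ→ℚᵘ p d k)

-- p/q ↦ (p(n+1) + 1)/(q(n+1)) = p/q + 1/(q(n+1)); the second field of mkℚᵘ is the
-- denominator minus one, and n + (q−1)(n+1) = q(n+1) − 1.
nudgeᵘ : ℚ → ℕ → ℚᵘ
nudgeᵘ (mkℚ p d _) n = mkℚᵘ (p ℤ.* +[1+ n ] ℤ.+ 1ℤ) (n ℕ.+ d ℕ.* suc n)

nudge : ℚ → ℕ → ℚ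
nudge r n = fromℚᵘ (nudgeᵘ r n)

<-nudge : ∀ r n → r < nudge r n
<-nudge r@(mkℚ p d _) n =
  ℚP.toℚᵘ-cancel-< (UP.<-respʳ-≃ (UP.≃-sym (ℚP.toℚᵘ-fromℚᵘ (nudgeᵘ r n))) (*<* cross))
  where
  open ℤP.≤-Reasoning
  N Q : ℤ
  N = +[1+ n ]
  Q = +[1+ d ]
  shift : ∀ p Q N → p ℤ.* (Q ℤ.* N) ℤ.+ Q ≡ (p ℤ.* N ℤ.+ 1ℤ) ℤ.* Q
  shift = solve-∀
  cross : p ℤ.* + (suc d ℕ.* suc n) ℤ.< (p ℤ.* N ℤ.+ 1ℤ) ℤ.* Q
  cross = begin-strict
    p ℤ.* + (suc d ℕ.* suc n)   ≡⟨ cong (p ℤ.*_) (ℤP.pos-* (suc d) (suc n)) ⟩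
    p ℤ.* (Q ℤ.* N)             ≡⟨ ℤP.+-identityʳ _ ⟨
    p ℤ.* (Q ℤ.* N) ℤ.+ + 0     <⟨ ℤP.+-monoʳ-< (p ℤ.* (Q ℤ.* N)) (+<+ (s≤s z≤n)) ⟩
    p ℤ.* (Q ℤ.* N) ℤ.+ Q       ≡⟨ shift p Q N ⟩
    (p ℤ.* N ℤ.+ 1ℤ) ℤ.* Q      ∎

-- Since p k / q < a has slack at least 1/q, adding k/(q(n+1)) ≤ 1/q keeps it below a.
nudge-cross-≤ : ∀ p d n {k a} → k ℕ.≤ suc n → mkℚᵘ (p ℤ.* + k) d U.< ℕ→ℚᵘ a →
  mkℚᵘ ((p ℤ.* +[1+ n ] ℤ.+ 1ℤ) ℤ.* + k) (n ℕ.+ d ℕ.* suc n) U.≤ ℕ→ℚᵘ a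
nudge-cross-≤ p d n {k} {a} k≤N (*<* pk<aQ) = *≤* (begin
  (p ℤ.* N ℤ.+ 1ℤ) ℤ.* K ℤ.* 1ℤ   ≡⟨ expand p N K ⟩
  p ℤ.* K ℤ.* 1ℤ ℤ.* N ℤ.+ K      ≤⟨ ℤP.+-monoʳ-≤ (p ℤ.* K ℤ.* 1ℤ ℤ.* N) (+≤+ k≤N) ⟩
  p ℤ.* K ℤ.* 1ℤ ℤ.* N ℤ.+ N      ≡⟨ collect (p ℤ.* K ℤ.* 1ℤ) N ⟩
  ℤ.suc (p ℤ.* K ℤ.* 1ℤ) ℤ.* N    ≤⟨ ℤP.*-monoʳ-≤-nonNeg N (ℤP.i<j⇒suc[i]≤j pk<aQ) ⟩
  + a ℤ.* Q ℤ.* N                 ≡⟨ ℤP.*-assoc (+ a) Q N ⟩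
  + a ℤ.* (Q ℤ.* N)               ≡⟨ cong (+ a ℤ.*_) (ℤP.pos-* (suc d) (suc n)) ⟨
  + a ℤ.* + (suc d ℕ.* suc n)     ∎)
  where
  open ℤP.≤-Reasoning
  N Q K : ℤ
  N = +[1+ n ]
  Q = +[1+ d ]
  K = + k
  expand : ∀ p N K → (p ℤ.* N ℤ.+ 1ℤ) ℤ.* K ℤ.* 1ℤ ≡ p ℤ.* K ℤ.* 1ℤ ℤ.* N ℤ.+ K
  expand = solve-∀
  collect : ∀ x N → x ℤ.* N ℤ.+ N ≡ (1ℤ ℤ.+ x) ℤ.* N
  collect = solve-∀

nudge-*-≤ : ∀ r n {k a} → k ℕ.≤ suc n → r ℚ.* ℕ→ℚ k < ℕ→ℚ a → nudge r n ℚ.* ℕ→ℚ k ℚ.≤ ℕ→ℚ a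
nudge-*-≤ r@(mkℚ p d _) n {k} {a} k≤N rk<a = ℚP.toℚᵘ-cancel-≤ (begin
  toℚᵘ (nudge r n ℚ.* ℕ→ℚ k)   ≃⟨ toℚᵘ-*ℕ→ℚ (nudge r n) k ⟩
  toℚᵘ (nudge r n) U.* ℕ→ℚᵘ k  ≃⟨ UP.*-congʳ (ℚP.toℚᵘ-fromℚᵘ (nudgeᵘ r n)) ⟩
  nudgeᵘ r n U.* ℕ→ℚᵘ k        ≃⟨ *ℕ→ℚᵘ (p ℤ.* +[1+ n ] ℤ.+ 1ℤ) (n ℕ.+ d ℕ.* suc n) k ⟩
  mkℚᵘ ((p ℤ.* +[1+ n ] ℤ.+ 1ℤ) ℤ.* + k) (n ℕ.+ d ℕ.* suc n)
                               ≤⟨ nudge-cross-≤ p d n k≤N pk<a ⟩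
  ℕ→ℚᵘ a                       ≃⟨ toℚᵘ-ℕ→ℚ a ⟨
  toℚᵘ (ℕ→ℚ a)                 ∎)
  where
  open UP.≤-Reasoning
  pk<a : mkℚᵘ (p ℤ.* + k) d U.< ℕ→ℚᵘ a
  pk<a = UP.<-respˡ-≃ (toℚᵘ-*ℕ→ℚ-cross r k) (UP.<-respʳ-≃ (toℚᵘ-ℕ→ℚ a) (ℚP.toℚᵘ-mono-< rk<a))

HasDenominatorBelow : ℕ → ℚ → Set
HasDenominatorBelow n r = ∃₂ λ a k → 0 ℕ.< k × k ℕ.< n × r ℚ.* ℕ→ℚ k ≡ ℕ→ℚ a

toughness-hasDenominatorBelow : ∀ {n} {G : Graph n} {r} → Connected G → IsToughness G r →
  ¬ ¬ HasDenominatorBelow n r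
toughness-hasDenominatorBelow {n} {G} {r} conn (tough , maximal) no-tight-cut =
  maximal (nudge r n) (<-nudge r n) nudge-tough
  where
  nudge-tough : Tough G (nudge r n)
  nudge-tough S k hc 1<k = nudge-*-≤ r n {k} {card S} (ℕP.m≤n⇒m≤1+n (ℕP.<⇒≤ {k} k<n))
    (≤∧≢⇒< (tough S k hc 1<k) λ tight → no-tight-cut (card S , k , ℕP.<⇒≤ {1} 1<k , k<n , tight))
    where
    k<n : k ℕ.< n
    k<n = ComponentLabelling.components<order hc conn 1<k

*ℕ→ℚ≡⇒≃ : ∀ r {a k₀} → r ℚ.* ℕ→ℚ (suc k₀) ≡ ℕ→ℚ a → toℚᵘ r U.≃ mkℚᵘ (+ a) k₀
*ℕ→ℚ≡⇒≃ r@(mkℚ p d _) {a} {k₀} rk≡a = *≡* (trans (sym (ℤP.*-identityʳ _)) (UP.drop-*≡* rk≃a))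
  where
  rk≃a : mkℚᵘ (p ℤ.* + suc k₀) d U.≃ ℕ→ℚᵘ a
  rk≃a = UP.≃-trans (UP.≃-sym (toℚᵘ-*ℕ→ℚ-cross r (suc k₀)))
                    (UP.≃-trans (ℚP.toℚᵘ-cong rk≡a) (toℚᵘ-ℕ→ℚ a))

-- |p/k − p'/k'| = |p k' − p' k| / (k k'), and a nonzero integer numerator is at least 1.
fractionᵘ-separation : ∀ m p k₀ p' k₀' → suc k₀ ℕ.< suc m → suc k₀' ℕ.< suc m →
  ¬ mkℚᵘ p k₀ U.≃ mkℚᵘ p' k₀' → mkℚᵘ 1ℤ (m ℕ.+ m ℕ.* suc m) U.< U.∣ mkℚᵘ p k₀ U.- mkℚᵘ p' k₀' ∣
fractionᵘ-separation m p k₀ p' k₀' k<n k'<n distinct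
  with ℤ.∣ p ℤ.* +[1+ k₀' ] ℤ.+ ℤ.- p' ℤ.* +[1+ k₀ ] ∣ in numerator
... | zero = contradiction (*≡* (ℤP.i-j≡0⇒i≡j _ _ (trans
        (cong (ℤ._+_ (p ℤ.* +[1+ k₀' ])) (ℤP.neg-distribˡ-* p' +[1+ k₀ ])) (ℤP.∣i∣≡0⇒i≡0 numerator))))
      distinct
... | suc j = *<* (subst₂ ℤ._<_ (sym (ℤP.*-identityˡ _)) (ℤP.pos-* (suc j) (suc m ℕ.* suc m))
        (+<+ (ℕP.<-≤-trans (ℕP.*-mono-< k<n k'<n) (ℕP.m≤m+n (suc m ℕ.* suc m) (j ℕ.* (suc m ℕ.* suc m))))))

toℚᵘ-distance : ∀ r s → toℚᵘ ∣ r - s ∣ U.≃ U.∣ toℚᵘ r U.- toℚᵘ s ∣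
toℚᵘ-distance r s = UP.≃-trans (ℚP.toℚᵘ-homo-∣-∣ (r - s))
  (UP.∣-∣-cong (UP.≃-trans (ℚP.toℚᵘ-homo-+ r (ℚ.- s)) (UP.+-congʳ (toℚᵘ r) (ℚP.toℚᵘ-homo‿- s))))

fraction-separation : ∀ {n r s} → HasDenominatorBelow n r → HasDenominatorBelow n s → r ≢ s →
  1/n² n < ∣ r - s ∣
fraction-separation {suc m} {r} {s} (a , suc k₀ , _ , k<n , rk≡a) (a' , suc k₀' , _ , k'<n , sk'≡a') r≢s =
  ℚP.toℚᵘ-cancel-< (begin-strict
    toℚᵘ (1/n² (suc m))                       ≃⟨ ℚP.toℚᵘ-fromℚᵘ (mkℚᵘ 1ℤ (m ℕ.+ m ℕ.* suc m)) ⟩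
    mkℚᵘ 1ℤ (m ℕ.+ m ℕ.* suc m)               <⟨ fractionᵘ-separation m (+ a) k₀ (+ a') k₀' k<n k'<n distinct ⟩
    U.∣ mkℚᵘ (+ a) k₀ U.- mkℚᵘ (+ a') k₀' ∣  ≃⟨ UP.∣-∣-cong (UP.+-cong r≃ (UP.-‿cong s≃)) ⟨
    U.∣ toℚᵘ r U.- toℚᵘ s ∣                   ≃⟨ toℚᵘ-distance r s ⟨
    toℚᵘ ∣ r - s ∣                            ∎)
  where
  open UP.≤-Reasoning
  r≃ : toℚᵘ r U.≃ mkℚᵘ (+ a) k₀
  r≃ = *ℕ→ℚ≡⇒≃ r rk≡a
  s≃ : toℚᵘ s U.≃ mkℚᵘ (+ a') k₀'
  s≃ = *ℕ→ℚ≡⇒≃ s sk'≡a'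
  distinct : ¬ mkℚᵘ (+ a) k₀ U.≃ mkℚᵘ (+ a') k₀'
  distinct a≃a' = r≢s (ℚP.toℚᵘ-injective (UP.≃-trans r≃ (UP.≃-trans a≃a' (UP.≃-sym s≃))))

corollary2p4 : (n : ℕ) (G H : Graph n) → Connected G → Connected H
    → NonComplete G → NonComplete H → (τG τH : ℚ) → IsToughness G τG → IsToughness H τH
    → τG ≢ τH → 1/n² n < ∣ τG - τH ∣
corollary2p4 n G H cG cH _ _ τG τH tG tH τG≢τH =
  decidable-stable (1/n² n ℚ.<? ∣ τG - τH ∣) λ ≮ →
    toughness-hasDenominatorBelow cG tG λ fG →
    toughness-hasDenominatorBelow cH tH λ fH →
    ≮ (fraction-separation fG fH τG≢τH)
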